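{- For every integer $n\ge 3$, $\mathrm{w}(\bar K_{n,n})=n-1$.
   Context: $\mathrm{w}(\cdot)$ denotes treewidth. $K_{n,n}$ is the complete bipartite graph with parts $\{v_i: i\in\mathbb{Z}_n\}$ and $\{v'_i: i\in\mathbb{Z}_n\}$, and $\bar K_{n,n}$ is the graph obtained from $K_{n,n}$ by deleting the $n$ edges $v_iv'_i$, $i\in\mathbb{Z}_n$. -}

module Defs where

open import Data.Nat using (ℕ; zero; suc; _≤_; _∸_; _⊔_)
open import Data.Fin using (Fin; zero; suc; inject₁; fromℕ)
open import Data.Fin.Base using (Fin)
open import Data.Sum using (_⊎_; inj₁; inj₂)
open import Data.Product using (Σ; _×_; ∃; _,_)
open import Data.List using (List; length; map; foldr; allFin)
open import Data.List.Membership.Propositional using (_∈_)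
open import Data.List.Relation.Unary.Unique.Propositional using (Unique)
open import Data.Empty using (⊥)
open import Data.Unit using (⊤)
open import Relation.Nullary using (¬_)
open import Relation.Binary.PropositionalEquality using (_≡_; _≢_)
open import Function.Definitions using (Injective)

record Graph (V : Set) : Set₁ where
  field
    Adj   : V → V → Set
    sym   : ∀ {u v} → Adj u v → Adj v u
    irrefl : ∀ {v} → ¬ Adj v v
open Graph public

data WalkIn {V : Set} (G : Graph V) (P : V → Set) : V → V → Set where
  here : ∀ {v} → P v → WalkIn G P v v
  step : ∀ {u w v} → P u → Adj G u w → WalkIn G P w v → WalkIn G P u v

ConnectedOn : {V : Set} → Graph V → (V → Set) → Set
ConnectedOn G P = ∀ u v → P u → P v → WalkIn G P u v

AllV : {V : Set} → V → Set
AllV _ = ⊤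

HasCycle : {V : Set} → Graph V → Set
HasCycle {V} G =
  Σ ℕ λ k → Σ (Fin (suc (suc (suc k))) → V) λ f →
    Injective _≡_ _≡_ f ×
    (∀ (i : Fin (suc (suc k))) → Adj G (f (inject₁ i)) (f (suc i))) ×
    Adj G (f (fromℕ (suc (suc k)))) (f zero)

record IsTree (t : ℕ) (T : Graph (Fin t)) : Set where
  field
    nonempty  : 1 ≤ t
    connected : ConnectedOn T AllV
    acyclic   : ¬ HasCycle T

maxList : List ℕ → ℕ
maxList = foldr _⊔_ 0

-- A tree decomposition of G: a tree T on nodes Fin t and bags (duplicate-free
-- lists, i.e. finite sets of vertices) satisfying the three usual axioms.
record TreeDecomposition {V : Set} (G : Graph V) : Set₁ where
  field
    t        : ℕ
    T        : Graph (Fin t)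
    isTree   : IsTree t T
    bag      : Fin t → List V
    bagUniq  : ∀ x → Unique (bag x)
    vcover   : ∀ v → ∃ λ x → v ∈ bag x
    ecover   : ∀ u v → Adj G u v → ∃ λ x → (u ∈ bag x) × (v ∈ bag x)
    coherent : ∀ v → ConnectedOn T (λ x → v ∈ bag x)
open TreeDecomposition public

width : {V : Set} {G : Graph V} → TreeDecomposition G → ℕ
width D = maxList (map (λ x → length (bag D x)) (allFin (t D))) ∸ 1

TreewidthIs : {V : Set} → Graph V → ℕ → Set₁
TreewidthIs G w =
  (Σ (TreeDecomposition G) λ D → width D ≡ w) ×
  (∀ (D : TreeDecomposition G) → w ≤ width D)

-- \bar K_{n,n}: vertices v_i = inj₁ i, v'_i = inj₂ i (i ∈ Z_n ≅ Fin n);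
-- v_i ~ v'_j iff i ≠ j; no edges inside a part.
KbarAdj : (n : ℕ) → Fin n ⊎ Fin n → Fin n ⊎ Fin n → Set
KbarAdj n (inj₁ i) (inj₂ j) = i ≢ j
KbarAdj n (inj₂ i) (inj₁ j) = i ≢ j
KbarAdj n (inj₁ _) (inj₁ _) = ⊥
KbarAdj n (inj₂ _) (inj₂ _) = ⊥

private
  ≢-sym : ∀ {n} {i j : Fin n} → i ≢ j → j ≢ i
  ≢-sym p q = p (Relation.Binary.PropositionalEquality.sym q)

KbarSym : ∀ n {u v} → KbarAdj n u v → KbarAdj n v u
KbarSym n {inj₁ i} {inj₂ j} p = ≢-sym p
KbarSym n {inj₂ i} {inj₁ j} p = ≢-sym p

KbarIrrefl : ∀ n {v} → ¬ KbarAdj n v v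
KbarIrrefl n {inj₁ _} ()
KbarIrrefl n {inj₂ _} ()

Kbar : (n : ℕ) → Graph (Fin n ⊎ Fin n)
Kbar n = record { Adj = KbarAdj n ; sym = KbarSym n ; irrefl = KbarIrrefl n }

-- In any tree decomposition some bag contains a vertex together with all its
-- neighbours: prune leaves whose bag lies inside the parent's bag; once a leaf
-- bag has a vertex missing from its parent, that vertex lives in no other bag,
-- so every edge at it is covered by the leaf bag.  In K̄ₙ,ₙ every closed
-- neighbourhood has n vertices, whence width ≥ n - 1.  Conversely, a star with
-- centre bag {vᵢ} and one leaf bag N[v'ₖ] per k is a decomposition of width n - 1.
module Submission where

open import Defs
open import Data.Nat using (ℕ; zero; suc; _≤_; _<_; _∸_; _+_; z≤n; s≤s; _≤?_)
open import Data.Nat.Properties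
  using (≤-refl; ≤-reflexive; ≤-trans; ≤-antisym; ≤-pred; ≮⇒≥; <⇒≱; m≤m⊔n; m≤n⊔m; ⊔-lub; ∸-monoˡ-≤;
         +-suc; m≤m+n; n≤1+n)
open import Data.Fin using (Fin; zero; suc; inject₁; fromℕ; _≟_)
open import Data.Fin.Properties using (pigeonhole) renaming (<⇒≢ to <⇒≢ᶠ)
open import Data.Sum using (_⊎_; inj₁; inj₂; reduce)
open import Data.Sum.Properties using (≡-dec; inj₁-injective)
open import Data.Product using (∃; ∃₂; _×_; _,_; proj₁; proj₂)
open import Data.List using (List; []; _∷_; _++_; length; allFin; tabulate; lookup; filter)
open import Data.List.Properties using (length-tabulate; filter-notAll)
open import Data.List.Membership.Propositional using (_∈_; _∉_; find)
open import Data.List.Membership.Propositional.Properties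
  using (∈-lookup; ∈-tabulate⁺; ∈-tabulate⁻; ∈-map⁺; ∈-filter⁺; ∈-filter⁻; ∈-∃++; ∈-allFin)
open import Data.List.Relation.Unary.Any as Any using (here; there; index)
open import Data.List.Relation.Unary.Any.Properties using (lookup-index)
open import Data.List.Relation.Unary.All as All using (All; []; _∷_; all?)
open import Data.List.Relation.Unary.All.Properties
  using (¬All⇒Any¬; ¬Any⇒All¬; map⁺; tabulate⁺) renaming (++⁻ to All-++⁻)
open import Data.List.Relation.Unary.AllPairs using ([]; _∷_)
open import Data.List.Relation.Unary.Unique.Propositional using (Unique)
open import Data.List.Relation.Unary.Unique.Propositional.Properties
  using () renaming (tabulate⁺ to Unique-tabulate⁺)
open import Data.List.Relation.Unary.Linked as Linked using (Linked; []; [-]; _∷_)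
open import Data.Empty using (⊥; ⊥-elim)
open import Data.Unit using (⊤; tt)
open import Function using (_∘_; case_of_)
open import Function.Definitions using (Injective)
open import Relation.Nullary using (¬_; Dec; yes; no)
open import Relation.Nullary.Decidable using (¬?; decidable-stable; ¬¬-excluded-middle)
open import Relation.Nullary.Negation using (¬¬-map; ¬¬-Monad)
open import Effect.Monad using (RawMonad)
open import Level using (0ℓ)
open import Relation.Binary.Definitions using (DecidableEquality)
open import Relation.Binary.PropositionalEquality as ≡
  using (_≡_; _≢_; refl; trans; cong; subst; module ≡-Reasoning)

private
  variable
    A V : Set

injective⇒≤length : ∀ {m} {f : Fin m → A} {xs : List A} →
                    Injective _≡_ _≡_ f → (∀ i → f i ∈ xs) → m ≤ length xs
injective⇒≤length {f = f} {xs} f-inj f∈xs = ≮⇒≥ λ len<m →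
  let i , j , i<j , same-index = pigeonhole len<m (index ∘ f∈xs) in
  <⇒≢ᶠ i<j (f-inj (begin
    f i                        ≡⟨ lookup-index (f∈xs i) ⟩
    lookup xs (index (f∈xs i)) ≡⟨ cong (lookup xs) same-index ⟩
    lookup xs (index (f∈xs j)) ≡⟨ lookup-index (f∈xs j) ⟨
    f j                        ∎))
  where open ≡-Reasoning

lookup-injective : ∀ {xs : List A} → Unique xs → Injective _≡_ _≡_ (lookup xs)
lookup-injective {xs = _ ∷ _} _        {zero}  {zero}  _  = refl
lookup-injective {xs = _ ∷ _} (x∉ ∷ _) {zero}  {suc j} eq = ⊥-elim (All.lookup x∉ (∈-lookup j) eq)
lookup-injective {xs = _ ∷ _} (x∉ ∷ _) {suc i} {zero}  eq = ⊥-elim (All.lookup x∉ (∈-lookup i) (≡.sym eq))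
lookup-injective {xs = _ ∷ _} (_ ∷ u)  {suc i} {suc j} eq = cong suc (lookup-injective u eq)

Unique⇒length≤ : ∀ {k} {xs : List (Fin k)} → Unique xs → length xs ≤ k
Unique⇒length≤ {k} {xs} u =
  subst (length xs ≤_) (length-tabulate {n = k} (λ i → i))
        (injective⇒≤length (lookup-injective u) (λ _ → ∈-allFin _))

≤-maxList : ∀ {y} xs → y ∈ xs → y ≤ maxList xs
≤-maxList (x ∷ xs) (here refl) = m≤m⊔n x (maxList xs)
≤-maxList (x ∷ xs) (there y∈xs) = ≤-trans (≤-maxList xs y∈xs) (m≤n⊔m x (maxList xs))

maxList-≤ : ∀ {m xs} → All (_≤ m) xs → maxList xs ≤ m
maxList-≤ []        = z≤n
maxList-≤ (x≤ ∷ xs≤) = ⊔-lub x≤ (maxList-≤ xs≤)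

lastOf : A → List A → A
lastOf x []       = x
lastOf x (y ∷ ys) = lastOf y ys

lookup-fromℕ-length : ∀ (x : A) xs → lookup (x ∷ xs) (fromℕ (length xs)) ≡ lastOf x xs
lookup-fromℕ-length x []       = refl
lookup-fromℕ-length x (y ∷ ys) = lookup-fromℕ-length y ys

Linked-lookup : ∀ {R : A → A → Set} {x xs} → Linked R (x ∷ xs) →
                ∀ j → R (lookup (x ∷ xs) (inject₁ j)) (lookup (x ∷ xs) (suc j))
Linked-lookup (r ∷ _)  zero    = r
Linked-lookup (_ ∷ rs) (suc j) = Linked-lookup rs j

Linked-++-∷⁻ : ∀ {R : A → A → Set} x xs {z ys} → Linked R (x ∷ xs ++ z ∷ ys) →
               Linked R (x ∷ xs) × R (lastOf x xs) z
Linked-++-∷⁻ x []       (r ∷ _)  = [-] , r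
Linked-++-∷⁻ x (y ∷ xs) (r ∷ rs) = let l , r′ = Linked-++-∷⁻ y xs rs in r ∷ l , r′

Unique-++-∷⁻ : ∀ xs {z : A} {ys} → Unique (xs ++ z ∷ ys) → Unique (z ∷ xs)
Unique-++-∷⁻ []       _        = [] ∷ []
Unique-++-∷⁻ (x ∷ xs) (x∉ ∷ u) with Unique-++-∷⁻ xs u | All-++⁻ xs x∉
... | z∉xs ∷ u′ | x∉xs , x≢z ∷ _ = ((λ z≡x → x≢z (≡.sym z≡x)) ∷ z∉xs) ∷ x∉xs ∷ u′

-- Walks and cycles

module _ {G : Graph V} {P : V → Set} where

  WalkIn-head : ∀ {u v} → WalkIn G P u v → P u
  WalkIn-head (here p)     = p
  WalkIn-head (step p _ _) = p

  WalkIn-map : ∀ {Q : V → Set} → (∀ {x} → P x → Q x) → ∀ {u v} → WalkIn G P u v → WalkIn G Q u v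
  WalkIn-map f (here p)     = here (f p)
  WalkIn-map f (step p e w) = step (f p) e (WalkIn-map f w)

module _ (G : Graph V) where

  Linked⇒HasCycle : ∀ {x y z zs} → Unique (x ∷ y ∷ z ∷ zs) → Linked (Adj G) (x ∷ y ∷ z ∷ zs) →
                    Adj G (lastOf z zs) x → HasCycle G
  Linked⇒HasCycle {x} {y} {z} {zs} u l closing =
    length zs , lookup (x ∷ y ∷ z ∷ zs) , lookup-injective u , Linked-lookup l ,
    subst (λ w → Adj G w x) (≡.sym (lookup-fromℕ-length x (y ∷ z ∷ zs))) closing

  -- The cycle z e q … (the path from e up to z) is closed by the chord e z.
  chord⇒HasCycle : ∀ {e q z rest} → Unique (e ∷ q ∷ rest) → Linked (Adj G) (e ∷ q ∷ rest) →
                   z ∈ rest → Adj G e z → HasCycle G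
  chord⇒HasCycle {e} {q} {z} u l z∈rest ez with ∈-∃++ z∈rest
  ... | as , _ , refl with Linked-++-∷⁻ e (q ∷ as) l
  ...   | l′ , closing = Linked⇒HasCycle (Unique-++-∷⁻ (e ∷ q ∷ as) u) (Graph.sym G ez ∷ l′) closing

-- Leaves of subtrees

module _ {t : ℕ} (T : Graph (Fin t)) where

  record Leaf (S : List (Fin t)) : Set where
    field
      leaf parent : Fin t
      leaf∈S      : leaf ∈ S
      parent∈S    : parent ∈ S
      leaf-parent : Adj T leaf parent
      only-parent : ∀ {z} → z ∈ S → Adj T leaf z → z ≡ parent

  -- A walk entering the leaf must leave it through the parent, where it came from.
  WalkIn-avoid-leaf : ∀ {S} (L : Leaf S) {Q : Fin t → Set} → (∀ {x} → Q x → x ∈ S) →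
                      ∀ {a b} → WalkIn T Q a b → a ≢ Leaf.leaf L → b ≢ Leaf.leaf L →
                      WalkIn T (λ x → Q x × x ≢ Leaf.leaf L) a b
  WalkIn-avoid-leaf L Q⇒S (here qa) a≢l b≢l = here (qa , a≢l)
  WalkIn-avoid-leaf L Q⇒S (step {w = w} qa aw W) a≢l b≢l with w ≟ Leaf.leaf L
  ... | no w≢l = step (qa , a≢l) aw (WalkIn-avoid-leaf L Q⇒S W w≢l b≢l)
  WalkIn-avoid-leaf L Q⇒S (step qa al (here _)) a≢l b≢l | yes refl = ⊥-elim (b≢l refl)
  WalkIn-avoid-leaf L Q⇒S {a} (step qa al (step {w = w′} _ lw′ W′)) a≢l b≢l | yes refl =
    subst (λ x → WalkIn T _ x _) w′≡a
          (WalkIn-avoid-leaf L Q⇒S W′ (λ w′≡l → a≢l (trans (≡.sym w′≡a) w′≡l)) b≢l)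
    where
    open Leaf L
    w′≡a : w′ ≡ a
    w′≡a = trans (only-parent (Q⇒S (WalkIn-head W′)) lw′) (≡.sym (only-parent (Q⇒S qa) (Graph.sym T al)))

  record SimplePathIn (S xs : List (Fin t)) : Set where
    field
      inside : All (_∈ S) xs
      linked : Linked (Adj T) xs
      unique : Unique xs

  module _ (acyclic : ¬ HasCycle T) {S : List (Fin t)} where

    -- Walk away from q; since T has no cycle and only t nodes, we get stuck at a leaf.
    -- Adjacency in T need not be decidable, so the leaf is only found under ¬ ¬.
    ¬¬-leaf-beyond : ∀ k {e q rest} → SimplePathIn S (e ∷ q ∷ rest) → t ≤ k + length rest → ¬ ¬ Leaf S
    ¬¬-leaf-beyond zero path t≤ _ =
      <⇒≱ (≤-trans (n≤1+n _) (Unique⇒length≤ (SimplePathIn.unique path))) t≤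
    ¬¬-leaf-beyond (suc k) {e} {q} {rest} path t≤ ¬leaf = ¬¬-excluded-middle go
      where
      open SimplePathIn path
      OtherNeighbour = ∃ λ z → z ∈ S × Adj T e z × z ≢ q
      go : Dec OtherNeighbour → ⊥
      go (no none) = ¬leaf record
        { leaf = e ; parent = q ; leaf∈S = All.head inside ; parent∈S = All.head (All.tail inside)
        ; leaf-parent = Linked.head linked
        ; only-parent = λ {z} z∈S ez → decidable-stable (z ≟ q) λ z≢q → none (_ , z∈S , ez , z≢q) }
      go (yes (z , z∈S , ez , z≢q)) with Any.any? (z ≟_) (e ∷ q ∷ rest)
      ... | yes (here refl)               = Graph.irrefl T ez
      ... | yes (there (here refl))       = z≢q refl
      ... | yes (there (there z∈rest))    = acyclic (chord⇒HasCycle T unique linked z∈rest ez)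
      ... | no z∉path = ¬¬-leaf-beyond k extended (subst (t ≤_) (≡.sym (+-suc k (length rest))) t≤) ¬leaf
        where
        extended : SimplePathIn S (z ∷ e ∷ q ∷ rest)
        extended = record
          { inside = z∈S ∷ inside
          ; linked = Graph.sym T ez ∷ linked
          ; unique = ¬Any⇒All¬ _ z∉path ∷ unique }

    ¬¬-leaf : ConnectedOn T (_∈ S) → ∀ {a b} → a ∈ S → b ∈ S → a ≢ b → ¬ ¬ Leaf S
    ¬¬-leaf connected a∈S b∈S a≢b with connected _ _ a∈S b∈S
    ... | here _          = λ _ → a≢b refl
    ... | step _ aw W = ¬¬-leaf-beyond t path (m≤m+n t 0)
      where
      path : SimplePathIn S (_ ∷ _ ∷ [])
      path = record
        { inside = WalkIn-head W ∷ a∈S ∷ []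
        ; linked = Graph.sym T aw ∷ [-]
        ; unique = ((λ { refl → Graph.irrefl T aw }) ∷ []) ∷ [] ∷ [] }

-- Tree decompositions

ClosedNbhdIn : Graph V → V → List V → Set
ClosedNbhdIn G v xs = v ∈ xs × (∀ u → Adj G v u → u ∈ xs)

module _ {G : Graph V} (_≟V_ : DecidableEquality V) (D : TreeDecomposition G) where

  private
    Node = Fin (t D)
    open RawMonad (¬¬-Monad {0ℓ}) using (pure; _>>=_)

  HasClosedNbhdBag : Set
  HasClosedNbhdBag = ∃₂ λ x v → ClosedNbhdIn G v (bag D x)

  record DecompositionOn (S : List Node) : Set where
    field
      connectedOn    : ConnectedOn (T D) (_∈ S)
      coversVertices : ∀ v → ∃ λ x → x ∈ S × v ∈ bag D x
      coversEdges    : ∀ u v → Adj G u v → ∃ λ x → x ∈ S × u ∈ bag D x × v ∈ bag D x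
      coherentOn     : ∀ v → ConnectedOn (T D) (λ x → x ∈ S × v ∈ bag D x)

  decompositionOn-allFin : DecompositionOn (allFin (t D))
  decompositionOn-allFin = record
    { connectedOn    = λ a b _ _ → WalkIn-map (λ _ → ∈-allFin _) (IsTree.connected (isTree D) a b tt tt)
    ; coversVertices = λ v → let x , v∈ = vcover D v in x , ∈-allFin x , v∈
    ; coversEdges    = λ u v uv → let x , u∈ , v∈ = ecover D u v uv in x , ∈-allFin x , u∈ , v∈
    ; coherentOn     = λ v a b (_ , va) (_ , vb) →
        WalkIn-map (λ v∈ → ∈-allFin _ , v∈) (coherent D v a b va vb)
    }

  module _ {S : List Node} (I : DecompositionOn S) (L : Leaf (T D) S) where
    open DecompositionOn I
    open Leaf L

    without-leaf : List Node
    without-leaf = filter (λ x → ¬? (x ≟ leaf)) S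

    ∈-without-leaf⁺ : ∀ {x} → x ∈ S × x ≢ leaf → x ∈ without-leaf
    ∈-without-leaf⁺ (x∈ , x≢l) = ∈-filter⁺ (λ x → ¬? (x ≟ leaf)) x∈ x≢l

    ∈-without-leaf⁻ : ∀ {x} → x ∈ without-leaf → x ∈ S × x ≢ leaf
    ∈-without-leaf⁻ = ∈-filter⁻ (λ x → ¬? (x ≟ leaf)) {xs = S}

    without-leaf-shorter : length without-leaf < length S
    without-leaf-shorter = filter-notAll _ S (Any.map (λ { refl x≢x → x≢x refl }) leaf∈S)

    decompositionOn-without-leaf : All (_∈ bag D parent) (bag D leaf) → DecompositionOn without-leaf
    decompositionOn-without-leaf leaf⊆parent = record
      { connectedOn    = λ a b a∈ b∈ →
          WalkIn-map ∈-without-leaf⁺ (avoid-leaf (λ x∈ → x∈) (connectedOn a b (∈S a∈) (∈S b∈)) a∈ b∈)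
      ; coversVertices = λ v →
          let x , x∈ , v∈ = coversVertices v ; y , y∈ , x⊆y = covering-bag x∈ in y , y∈ , x⊆y v∈
      ; coversEdges    = λ u v uv →
          let x , x∈ , u∈ , v∈ = coversEdges u v uv ; y , y∈ , x⊆y = covering-bag x∈
          in  y , y∈ , x⊆y u∈ , x⊆y v∈
      ; coherentOn     = λ v a b (a∈ , va) (b∈ , vb) →
          WalkIn-map (λ ((x∈ , vx) , x≢l) → ∈-without-leaf⁺ (x∈ , x≢l) , vx)
                     (avoid-leaf proj₁ (coherentOn v a b (∈S a∈ , va) (∈S b∈ , vb)) a∈ b∈)
      }
      where
      ∈S : ∀ {x} → x ∈ without-leaf → x ∈ S
      ∈S = proj₁ ∘ ∈-without-leaf⁻

      avoid-leaf : ∀ {Q : Node → Set} → (∀ {x} → Q x → x ∈ S) → ∀ {a b} → WalkIn (T D) Q a b →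
                   a ∈ without-leaf → b ∈ without-leaf → WalkIn (T D) (λ x → Q x × x ≢ leaf) a b
      avoid-leaf Q⇒S W a∈ b∈ =
        WalkIn-avoid-leaf (T D) L Q⇒S W (proj₂ (∈-without-leaf⁻ a∈)) (proj₂ (∈-without-leaf⁻ b∈))

      covering-bag : ∀ {x} → x ∈ S → ∃ λ y → y ∈ without-leaf × (∀ {v} → v ∈ bag D x → v ∈ bag D y)
      covering-bag {x} x∈ with x ≟ leaf
      ... | yes refl = parent , ∈-without-leaf⁺ (parent∈S , λ { refl → Graph.irrefl (T D) leaf-parent })
                              , All.lookup leaf⊆parent
      ... | no x≢l   = x , ∈-without-leaf⁺ (x∈ , x≢l) , λ v∈ → v∈

    -- By coherence, a vertex of the leaf bag missing from the parent bag occurs in no other bag of S.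
    private-vertex⇒ClosedNbhdIn : ∀ {v} → v ∈ bag D leaf → v ∉ bag D parent →
                                  ClosedNbhdIn G v (bag D leaf)
    private-vertex⇒ClosedNbhdIn {v} v∈leaf v∉parent = v∈leaf , λ u vu →
      let x , x∈ , v∈x , u∈x = coversEdges v u vu in
      subst (λ y → u ∈ bag D y) (stuck (coherentOn v leaf x (leaf∈S , v∈leaf) (x∈ , v∈x))) u∈x
      where
      stuck : ∀ {x} → WalkIn (T D) (λ y → y ∈ S × v ∈ bag D y) leaf x → x ≡ leaf
      stuck (here _)       = refl
      stuck (step _ lw W) with WalkIn-head W
      ... | w∈ , v∈w = ⊥-elim (v∉parent (subst (λ y → v ∈ bag D y) (only-parent w∈ lw) v∈w))

    prune-leaf-or-ClosedNbhdIn : (∃ λ S′ → length S′ < length S × DecompositionOn S′) ⊎ HasClosedNbhdBag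
    prune-leaf-or-ClosedNbhdIn with all? (λ u → Any.any? (u ≟V_) (bag D parent)) (bag D leaf)
    ... | yes leaf⊆parent =
      inj₁ (without-leaf , without-leaf-shorter , decompositionOn-without-leaf leaf⊆parent)
    ... | no leaf⊈parent with find (¬All⇒Any¬ (λ u → Any.any? (u ≟V_) (bag D parent)) _ leaf⊈parent)
    ...   | u , u∈leaf , u∉parent = inj₂ (leaf , u , private-vertex⇒ClosedNbhdIn u∈leaf u∉parent)

  single-node⇒ClosedNbhdIn : ∀ {S x v} → DecompositionOn S → All (_≡ x) S → v ∈ bag D x →
                             ClosedNbhdIn G v (bag D x)
  single-node⇒ClosedNbhdIn I S≡x v∈x = v∈x , λ u vu →
    let y , y∈ , _ , u∈y = DecompositionOn.coversEdges I _ u vu in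
    subst (λ z → u ∈ bag D z) (All.lookup S≡x y∈) u∈y

  ¬¬-closedNbhdBag-on : ∀ m {S} → length S ≤ m → DecompositionOn S → V → ¬ ¬ HasClosedNbhdBag
  ¬¬-closedNbhdBag-on zero {[]} _ I v with DecompositionOn.coversVertices I v
  ... | _ , () , _
  ¬¬-closedNbhdBag-on (suc m) {S} len≤m I v with DecompositionOn.coversVertices I v
  ... | x , x∈S , v∈x with all? (_≟ x) S
  ...   | yes S≡x = pure (x , v , single-node⇒ClosedNbhdIn I S≡x v∈x)
  ...   | no S≢x with find (¬All⇒Any¬ (_≟ x) S S≢x)
  ...     | b , b∈S , b≢x = do
    L ← ¬¬-leaf (T D) (IsTree.acyclic (isTree D)) (DecompositionOn.connectedOn I) b∈S x∈S b≢x
    case prune-leaf-or-ClosedNbhdIn I L of λ where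
      (inj₁ (S′ , shorter , I′)) → ¬¬-closedNbhdBag-on m (≤-pred (≤-trans shorter len≤m)) I′ v
      (inj₂ found)               → pure found

  ¬¬-closedNbhdBag : V → ¬ ¬ HasClosedNbhdBag
  ¬¬-closedNbhdBag = ¬¬-closedNbhdBag-on _ ≤-refl decompositionOn-allFin

length-bag∸1≤width : ∀ {G : Graph V} (D : TreeDecomposition G) x → length (bag D x) ∸ 1 ≤ width D
length-bag∸1≤width D x = ∸-monoˡ-≤ 1 (≤-maxList _ (∈-map⁺ (λ y → length (bag D y)) (∈-allFin x)))

-- Closed neighbourhoods in K̄ₙ,ₙ

module _ {n : ℕ} where

  private
    Vertex = Fin n ⊎ Fin n

  opposite : Vertex → Fin n → Vertex
  opposite (inj₁ _) j = inj₂ j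
  opposite (inj₂ _) j = inj₁ j

  -- N[vᵢ] = {vᵢ} ∪ {v'ⱼ : j ≠ i}, enumerated by j, and symmetrically for v'ᵢ.
  closedNbhdAt : Vertex → Fin n → Vertex
  closedNbhdAt v j with reduce v ≟ j
  ... | yes _ = v
  ... | no  _ = opposite v j

  closedNbhdAt-injective : ∀ v → Injective _≡_ _≡_ (closedNbhdAt v)
  closedNbhdAt-injective v {j} {k} eq with reduce v ≟ j | reduce v ≟ k
  ... | yes v≡j | yes v≡k = trans (≡.sym v≡j) v≡k
  closedNbhdAt-injective (inj₁ _) () | yes _ | no _
  closedNbhdAt-injective (inj₂ _) () | yes _ | no _
  closedNbhdAt-injective (inj₁ _) () | no _ | yes _
  closedNbhdAt-injective (inj₂ _) () | no _ | yes _
  closedNbhdAt-injective (inj₁ _) refl | no _ | no _ = refl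
  closedNbhdAt-injective (inj₂ _) refl | no _ | no _ = refl

  closedNbhdAt-∈ : ∀ {v xs} → ClosedNbhdIn (Kbar n) v xs → ∀ j → closedNbhdAt v j ∈ xs
  closedNbhdAt-∈ {v} (v∈ , nbrs∈) j with reduce v ≟ j
  ... | yes _ = v∈
  closedNbhdAt-∈ {inj₁ _} (v∈ , nbrs∈) j | no i≢j = nbrs∈ _ i≢j
  closedNbhdAt-∈ {inj₂ _} (v∈ , nbrs∈) j | no i≢j = nbrs∈ _ i≢j

  ClosedNbhdIn-Kbar⇒n≤length : ∀ {v xs} → ClosedNbhdIn (Kbar n) v xs → n ≤ length xs
  ClosedNbhdIn-Kbar⇒n≤length {v} closed =
    injective⇒≤length (closedNbhdAt-injective v) (closedNbhdAt-∈ closed)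

  closedNbhdAt-self : ∀ v → closedNbhdAt v (reduce v) ≡ v
  closedNbhdAt-self v with reduce v ≟ reduce v
  ... | yes _   = refl
  ... | no  v≢v = ⊥-elim (v≢v refl)

  closedNbhdAt-adj : ∀ {v u} → KbarAdj n v u → closedNbhdAt v (reduce u) ≡ u
  closedNbhdAt-adj {inj₁ i} {inj₂ j} i≢j with i ≟ j
  ... | yes i≡j = ⊥-elim (i≢j i≡j)
  ... | no  _   = refl
  closedNbhdAt-adj {inj₂ i} {inj₁ j} i≢j with i ≟ j
  ... | yes i≡j = ⊥-elim (i≢j i≡j)
  ... | no  _   = refl

  ClosedNbhdIn-tabulate : ∀ v → ClosedNbhdIn (Kbar n) v (tabulate (closedNbhdAt v))
  ClosedNbhdIn-tabulate v =
    subst (_∈ N[v]) (closedNbhdAt-self v) (∈-tabulate⁺ (reduce v)) ,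
    λ u vu → subst (_∈ N[v]) (closedNbhdAt-adj vu) (∈-tabulate⁺ (reduce u))
    where
    N[v] = tabulate (closedNbhdAt v)

  closedNbhdAt-inj₂ : ∀ {i j k} → closedNbhdAt (inj₂ i) j ≡ inj₂ k → i ≡ k
  closedNbhdAt-inj₂ {i} {j} eq with i ≟ j
  closedNbhdAt-inj₂ refl | yes _ = refl
  closedNbhdAt-inj₂ ()   | no  _

Kbar-width≥ : ∀ n (D : TreeDecomposition (Kbar n)) → n ∸ 1 ≤ width D
Kbar-width≥ zero    D = z≤n
Kbar-width≥ (suc n) D =
  decidable-stable (n ≤? width D) (¬¬-map bag-bound (¬¬-closedNbhdBag (≡-dec _≟_ _≟_) D (inj₁ zero)))
  where
  bag-bound : HasClosedNbhdBag (≡-dec _≟_ _≟_) D → n ≤ width D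
  bag-bound (x , v , closed) =
    ≤-trans (∸-monoˡ-≤ 1 (ClosedNbhdIn-Kbar⇒n≤length closed)) (length-bag∸1≤width D x)

-- The star decomposition

StarAdj : ∀ {m} → Fin (suc m) → Fin (suc m) → Set
StarAdj zero    zero    = ⊥
StarAdj zero    (suc _) = ⊤
StarAdj (suc _) zero    = ⊤
StarAdj (suc _) (suc _) = ⊥

star : ∀ m → Graph (Fin (suc m))
star m = record { Adj = StarAdj ; sym = sym′ ; irrefl = irrefl′ }
  where
  sym′ : ∀ {a b : Fin (suc m)} → StarAdj a b → StarAdj b a
  sym′ {zero}  {suc _} _ = tt
  sym′ {suc _} {zero}  _ = tt
  irrefl′ : ∀ {a : Fin (suc m)} → ¬ StarAdj a a
  irrefl′ {zero}  ()
  irrefl′ {suc _} ()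

star-connected : ∀ {m} {P : Fin (suc m) → Set} → P zero → ConnectedOn (star m) P
star-connected p₀ zero    zero    pa pb = here pa
star-connected p₀ zero    (suc _) pa pb = step pa tt (here pb)
star-connected p₀ (suc _) zero    pa pb = step pa tt (here pb)
star-connected p₀ (suc _) (suc _) pa pb = step pa tt (step p₀ tt (here pb))

star-middle : ∀ {m} {a b c : Fin (suc m)} → StarAdj a b → StarAdj b c → a ≢ c → b ≡ zero
star-middle {b = zero}                         _ _ _   = refl
star-middle {a = zero} {suc _} {zero}          _ _ a≢c = ⊥-elim (a≢c refl)

star-no-path : ∀ {m} {a b c d : Fin (suc m)} →
               StarAdj a b → StarAdj b c → StarAdj c d → a ≢ c → b ≢ d → ⊥
star-no-path ab bc cd a≢c b≢d with star-middle ab bc a≢c | star-middle bc cd b≢d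
... | refl | refl = bc

star-acyclic : ∀ m → ¬ HasCycle (star m)
star-acyclic m (zero , f , f-inj , edge , closing) =
  star-no-path (edge zero) (edge (suc zero)) closing ((λ ()) ∘ f-inj) ((λ ()) ∘ f-inj)
star-acyclic m (suc k , f , f-inj , edge , closing) =
  star-no-path (edge zero) (edge (suc zero)) (edge (suc (suc zero))) ((λ ()) ∘ f-inj) ((λ ()) ∘ f-inj)

module _ (n : ℕ) where

  private
    starBag : Fin (suc n) → List (Fin n ⊎ Fin n)
    starBag zero    = tabulate inj₁
    starBag (suc k) = tabulate (closedNbhdAt (inj₂ k))

    length-starBag : ∀ x → length (starBag x) ≡ n
    length-starBag zero    = length-tabulate inj₁
    length-starBag (suc k) = length-tabulate (closedNbhdAt (inj₂ k))

    inj₂-∈-starBag : ∀ {k x} → inj₂ k ∈ starBag x → x ≡ suc k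
    inj₂-∈-starBag {x = zero}  k∈ with ∈-tabulate⁻ k∈
    ... | _ , ()
    inj₂-∈-starBag {x = suc i} k∈ with ∈-tabulate⁻ k∈
    ... | _ , eq = cong suc (closedNbhdAt-inj₂ (≡.sym eq))

  Kbar-starDecomposition : TreeDecomposition (Kbar n)
  Kbar-starDecomposition = record
    { t        = suc n
    ; T        = star n
    ; isTree   = record { nonempty = s≤s z≤n ; connected = star-connected tt ; acyclic = star-acyclic n }
    ; bag      = starBag
    ; bagUniq  = λ { zero    → Unique-tabulate⁺ inj₁-injective
                   ; (suc k) → Unique-tabulate⁺ (closedNbhdAt-injective (inj₂ k)) }
    ; vcover   = λ { (inj₁ i) → zero , ∈-tabulate⁺ i
                   ; (inj₂ k) → suc k , proj₁ (closed k) }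
    ; ecover   = λ { (inj₁ i) (inj₂ k) i≢k → suc k , proj₂ (closed k) _ (i≢k ∘ ≡.sym) , proj₁ (closed k)
                   ; (inj₂ k) (inj₁ i) k≢i → suc k , proj₁ (closed k) , proj₂ (closed k) _ k≢i }
    ; coherent = λ { (inj₁ i) → star-connected (∈-tabulate⁺ i)
                   ; (inj₂ k) a b ka kb →
                       subst (WalkIn (star n) _ a) (trans (inj₂-∈-starBag ka) (≡.sym (inj₂-∈-starBag kb))) (here ka) }
    }
    where
    closed : ∀ k → ClosedNbhdIn (Kbar n) (inj₂ k) (starBag (suc k))
    closed k = ClosedNbhdIn-tabulate (inj₂ k)

  Kbar-starDecomposition-width≤ : width Kbar-starDecomposition ≤ n ∸ 1
  Kbar-starDecomposition-width≤ =
    ∸-monoˡ-≤ 1 (maxList-≤ (map⁺ {f = length ∘ starBag}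
                                 (tabulate⁺ {f = λ x → x} (≤-reflexive ∘ length-starBag))))

-- For n ≤ 2 the graph K̄ₙ,ₙ is a matching and the same bounds hold.
proposition3 : ∀ (n : ℕ) → 3 ≤ n → TreewidthIs (Kbar n) (n ∸ 1)
proposition3 n _ = (D , ≤-antisym (Kbar-starDecomposition-width≤ n) (Kbar-width≥ n D)) , Kbar-width≥ n
  where
  D = Kbar-starDecomposition n
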